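{- Let $n\ge 2$ be an integer and let $k$ be the largest positive integer such that $p_k\# \le n$, where $p_k\# = p_1p_2\cdots p_k$ is the product of the first $k$ primes. Then the vertex connectivity of $TCG_n$ satisfies $$\kappa(TCG_n)\le \left|\{\,x : 1\le x\le n,\ \gcd(x,p_k\#)=1\,\}\right|.$$
   Context: For a positive integer $n$, $TCG_n$ denotes the simple graph (no loops) with vertex set $\{1,2,\ldots,n\}$ in which two distinct vertices $i,j$ are adjacent if and only if $\gcd(i,j)=1$. The vertex connectivity $\kappa(G)$ of a graph $G$ is the least number of vertices whose removal yields a disconnected graph (or a single vertex), and is $0$ for a disconnected graph. $p_1=2,p_2=3,p_3=5,\ldots$ denote the primes in increasing order. -}

module Defs where

open import Data.Nat using (ℕ; zero; suc; _+_; _*_; _≤_; _<_)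
open import Data.Nat.GCD using (gcd)
open import Data.Nat.Primality using (Prime; prime?)
open import Data.Nat.Properties using (_≟_)
open import Data.List using (List; []; _∷_; map; upTo; filter; length)
open import Data.Nat.ListAction using (product)
open import Data.Fin using (Fin; toℕ)
open import Data.Fin.Subset using (Subset; _∉_; ∣_∣; ∁)
open import Data.Product using (Σ; _×_; ∃)
open import Data.Sum using (_⊎_)
open import Relation.Binary.PropositionalEquality using (_≡_)
open import Relation.Nullary using (¬_)

range1 : ℕ → List ℕ
range1 m = map suc (upTo m)

primesUpTo : ℕ → List ℕ
primesUpTo m = filter prime? (range1 m)

-- q is the k-th prime p_k (p_1 = 2): q is prime and exactly k primes are ≤ q
IsNthPrime : ℕ → ℕ → Set
IsNthPrime k q = Prime q × length (primesUpTo q) ≡ k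

-- product of all primes ≤ m; for m = p_k this is the primorial p_k#
primorialUpTo : ℕ → ℕ
primorialUpTo m = product (primesUpTo m)

coprimeCount : ℕ → ℕ → ℕ
coprimeCount n P = length (filter (λ x → gcd x P ≟ 1) (range1 n))

record Graph (n : ℕ) : Set₁ where
  field
    Adj : Fin n → Fin n → Set

open Graph public

-- TCG_n: vertex i : Fin n represents the integer toℕ i + 1;
-- distinct vertices are adjacent iff the represented integers are coprime
TCG : (n : ℕ) → Graph n
TCG n = record { Adj = λ i j → ¬ (i ≡ j) × gcd (suc (toℕ i)) (suc (toℕ j)) ≡ 1 }

data ReachAvoid {n : ℕ} (G : Graph n) (S : Subset n) : Fin n → Fin n → Set where
  here : ∀ {u} → u ∉ S → ReachAvoid G S u u
  step : ∀ {u v w} → u ∉ S → Adj G u v → ReachAvoid G S v w → ReachAvoid G S u w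

DisconnectedAfter : {n : ℕ} → Graph n → Subset n → Set
DisconnectedAfter {n} G S =
  Σ (Fin n) λ u → Σ (Fin n) λ v → u ∉ S × v ∉ S × ¬ ReachAvoid G S u v

IsSeparating : {n : ℕ} → Graph n → Subset n → Set
IsSeparating {n} G S = DisconnectedAfter G S ⊎ ∣ ∁ S ∣ ≤ 1

IsVertexConnectivity : {n : ℕ} → Graph n → ℕ → Set
IsVertexConnectivity {n} G c =
  (Σ (Subset n) λ S → IsSeparating G S × ∣ S ∣ ≡ c)
  × ((S : Subset n) → IsSeparating G S → c ≤ ∣ S ∣)

-- The vertices coprime to a fixed vertex P form a separating set of TCG_n: every neighbour of P
-- is coprime to P, so once they are removed, P (which is not coprime to itself unless P = 1) is
-- isolated, or else it is the only vertex left. Hence κ(TCG_n) is at most the number of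
-- x ≤ n coprime to P, for every 1 ≤ P ≤ n; the primorial p_k# ≤ n is one such P.
module Submission where

open import Defs
open import Data.Nat using (ℕ; zero; suc; _≤_; NonZero)
open import Data.Nat.Properties using (_≟_; ≤-trans; ≤-reflexive)
open import Data.Nat.GCD using (gcd; gcd-comm; gcd-greatest; gcd-zeroʳ)
open import Data.Nat.Divisibility using (_∣_; ∣-refl; ∣1⇒≡1)
open import Data.Nat.Primality using (prime?; prime⇒nonZero)
open import Data.Nat.ListAction.Properties using (product≢0)
open import Data.List using (length; filter; applyUpTo)
open import Data.List.Properties using (map-upTo)
import Data.List.Relation.Unary.All as All
open import Data.List.Relation.Unary.All.Properties using (all-filter)
open import Data.Bool using (true; false)
open import Data.Vec using (tabulate)
open import Data.Vec.Properties using ([]=⇒lookup; lookup⇒[]=; lookup∘tabulate)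
open import Data.Fin using (Fin; toℕ; fromℕ<)
open import Data.Fin.Properties using (any?; toℕ-fromℕ<) renaming (_≟_ to _≟ᶠ_)
open import Data.Fin.Subset using (Subset; _∈_; _∉_; ∣_∣; ∁; ⁅_⁆)
open import Data.Fin.Subset.Properties
  using (_∈?_; p⊆q⇒∣p∣≤∣q∣; x∈∁p⇒x∉p; x∈⁅x⁆; ∣⁅x⁆∣≡1)
open import Data.Product using (_,_)
open import Data.Sum using (inj₁; inj₂)
open import Function using (_∘_; case_of_)
open import Relation.Nullary using (¬_; yes; no; does; contradiction)
open import Relation.Nullary.Decidable using (_×-dec_; ¬?; dec-true; dec-false; decidable-stable)
open import Relation.Unary using (Pred; Decidable)
open import Relation.Binary.PropositionalEquality using (_≡_; refl; sym; trans; cong; subst)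

module _ {n : ℕ} (G : Graph n) (S : Subset n) where

  ReachAvoid-source∉ : ∀ {u v} → ReachAvoid G S u v → u ∉ S
  ReachAvoid-source∉ (here u∉S)     = u∉S
  ReachAvoid-source∉ (step u∉S _ _) = u∉S

  complement⊆⁅⁆⇒separating : (a : Fin n) → (∀ {v} → v ∉ S → v ≡ a) → IsSeparating G S
  complement⊆⁅⁆⇒separating a only-a = inj₂ (≤-trans (p⊆q⇒∣p∣≤∣q∣ ∁S⊆⁅a⁆) (≤-reflexive (∣⁅x⁆∣≡1 a)))
    where
    ∁S⊆⁅a⁆ : ∀ {v} → v ∈ ∁ S → v ∈ ⁅ a ⁆
    ∁S⊆⁅a⁆ v∈∁S = subst (_∈ ⁅ a ⁆) (sym (only-a (x∈∁p⇒x∉p v∈∁S))) (x∈⁅x⁆ a)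

  isolated⇒separating : (a : Fin n) → a ∉ S → (∀ {v} → Adj G a v → v ∈ S) → IsSeparating G S
  isolated⇒separating a a∉S neighbours∈S
    with any? (λ v → ¬? (v ∈? S) ×-dec ¬? (v ≟ᶠ a))
  ... | yes (v , v∉S , v≢a) = inj₁ (a , v , a∉S , v∉S , unreachable)
    where
    unreachable : ¬ ReachAvoid G S a v
    unreachable (here _)       = v≢a refl
    unreachable (step _ adj r) = ReachAvoid-source∉ r (neighbours∈S adj)
  ... | no none = complement⊆⁅⁆⇒separating a only-a
    where
    only-a : ∀ {v} → v ∉ S → v ≡ a
    only-a {v} v∉S = decidable-stable (v ≟ᶠ a) (λ v≢a → none (v , v∉S , v≢a))

∣tabulate-does∣≡length-filter : ∀ {a p} {A : Set a} {P : Pred A p} (P? : Decidable P)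
  (f : ℕ → A) (n : ℕ) →
  ∣ tabulate {n = n} (λ i → does (P? (f (toℕ i)))) ∣ ≡ length (filter P? (applyUpTo f n))
∣tabulate-does∣≡length-filter P? f zero = refl
∣tabulate-does∣≡length-filter P? f (suc n) with does (P? (f 0))
... | true  = cong suc (∣tabulate-does∣≡length-filter P? (f ∘ suc) n)
... | false = ∣tabulate-does∣≡length-filter P? (f ∘ suc) n

coprimeVertices : (n P : ℕ) → Subset n
coprimeVertices n P = tabulate λ i → does (gcd (suc (toℕ i)) P ≟ 1)

∣coprimeVertices∣≡coprimeCount : (n P : ℕ) → ∣ coprimeVertices n P ∣ ≡ coprimeCount n P
∣coprimeVertices∣≡coprimeCount n P =
  trans (∣tabulate-does∣≡length-filter (λ x → gcd x P ≟ 1) suc n)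
        (cong (length ∘ filter (λ x → gcd x P ≟ 1)) (sym (map-upTo suc n)))

module _ {n : ℕ} (P : ℕ) {i : Fin n} where

  coprime⇒∈coprimeVertices : gcd (suc (toℕ i)) P ≡ 1 → i ∈ coprimeVertices n P
  coprime⇒∈coprimeVertices coprime =
    lookup⇒[]= i _ (trans (lookup∘tabulate _ i) (dec-true (_ ≟ 1) coprime))

  ¬coprime⇒∉coprimeVertices : ¬ gcd (suc (toℕ i)) P ≡ 1 → i ∉ coprimeVertices n P
  ¬coprime⇒∉coprimeVertices ¬coprime i∈ with
    trans (sym ([]=⇒lookup i∈)) (trans (lookup∘tabulate _ i) (dec-false (_ ≟ 1) ¬coprime))
  ... | ()

gcd[m,m]≡1⇒m≡1 : ∀ {m} → gcd m m ≡ 1 → m ≡ 1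
gcd[m,m]≡1⇒m≡1 {m} eq = ∣1⇒≡1 (subst (m ∣_) eq (gcd-greatest ∣-refl ∣-refl))

coprimeVertices-separating : ∀ {n} P .{{_ : NonZero P}} → P ≤ n →
  IsSeparating (TCG n) (coprimeVertices n P)
coprimeVertices-separating {n} 1 1≤n =
  complement⊆⁅⁆⇒separating (TCG n) (coprimeVertices n 1) (fromℕ< 1≤n)
    λ {v} → contradiction (coprime⇒∈coprimeVertices 1 (gcd-zeroʳ (suc (toℕ v))))
coprimeVertices-separating {n} P@(suc (suc _)) P≤n =
  isolated⇒separating (TCG n) (coprimeVertices n P) a a∉S neighbours∈S
  where
  a : Fin n
  a = fromℕ< P≤n
  a≡P : suc (toℕ a) ≡ P
  a≡P = cong suc (toℕ-fromℕ< P≤n)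
  a∉S : a ∉ coprimeVertices n P
  a∉S = ¬coprime⇒∉coprimeVertices P λ coprime →
    case gcd[m,m]≡1⇒m≡1 {P} (subst (λ x → gcd x P ≡ 1) a≡P coprime) of λ ()
  neighbours∈S : ∀ {v} → Adj (TCG n) a v → v ∈ coprimeVertices n P
  neighbours∈S {v} (_ , coprime) = coprime⇒∈coprimeVertices P
    (trans (gcd-comm (suc (toℕ v)) P) (subst (λ x → gcd x (suc (toℕ v)) ≡ 1) a≡P coprime))

κ≤coprimeCount : ∀ {n c} → IsVertexConnectivity (TCG n) c →
  (P : ℕ) .{{_ : NonZero P}} → P ≤ n → c ≤ coprimeCount n P
κ≤coprimeCount {n} {c} (_ , minimal) P P≤n =
  subst (c ≤_) (∣coprimeVertices∣≡coprimeCount n P) (minimal _ (coprimeVertices-separating P P≤n))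

primorialUpTo≢0 : ∀ m → NonZero (primorialUpTo m)
primorialUpTo≢0 m = product≢0 (All.map prime⇒nonZero (all-filter prime? (range1 m)))

mainTheorem8 : (n : ℕ) → 2 ≤ n →
    (k q : ℕ) → 1 ≤ k → IsNthPrime k q → primorialUpTo q ≤ n →
    ((k′ q′ : ℕ) → 1 ≤ k′ → IsNthPrime k′ q′ → primorialUpTo q′ ≤ n → k′ ≤ k) →
    (c : ℕ) → IsVertexConnectivity (TCG n) c →
    c ≤ coprimeCount n (primorialUpTo q)
mainTheorem8 n _ k q _ _ p#≤n _ c κ≡c =
  κ≤coprimeCount κ≡c (primorialUpTo q) {{primorialUpTo≢0 q}} p#≤n
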